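{- Each of the following formulas is derivable in $FO\lambda^{\Delta\mathbb{N}}$ using the definition $\mathcal{D}_{list}(\tau)$ (with $\supset$ associating to the right): (1) $\forall l(list\,l\supset\forall l_1\forall l_2(split\,l\,l_1\,l_2\supset(list\,l_1\land list\,l_2)))$; (2) $\forall l_1(list\,l_1\supset\forall l_2(list\,l_2\supset\forall l(split\,l\,l_1\,l_2\supset list\,l)))$; (3) $\forall l(list\,l\supset\forall l_1\forall l_2(split\,l\,l_1\,l_2\supset(\forall x(element\,x\,l_1\supset element\,x\,l)\land\forall x(element\,x\,l_2\supset element\,x\,l))))$; (4) $\forall l(list\,l\supset\forall l_1\forall l_2(split\,l\,l_1\,l_2\supset split\,l\,l_2\,l_1))$; (5) $\forall l(list\,l\supset\forall l_{23}\forall l_1\forall l_2\forall l_3(split\,l\,l_1\,l_{23}\supset split\,l_{23}\,l_2\,l_3\supset\exists l_{12}(split\,l\,l_{12}\,l_3\land split\,l_{12}\,l_1\,l_2)))$; (6) $\forall l(list\,l\supset\forall l_{12}\forall l_1\forall l_2\forall l_3(split\,l\,l_{12}\,l_3\supset split\,l_{12}\,l_1\,l_2\supset\exists l_{23}(split\,l\,l_1\,l_{23}\land split\,l_{23}\,l_2\,l_3)))$; (7) $\forall l(list\,l\supset permute\,l\,l)$; (8) $\forall l(list\,l\supset\forall l'(permute\,l\,l'\supset list\,l'))$; (9) $\forall l(list\,l\supset\forall l'\forall l_1\forall l_2(list\,l'\supset permute\,l\,l'\supset split\,l\,l_1\,l_2\supset\exists l_1'\exists l_2'(permute\,l_1\,l_1'\land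 permute\,l_2\,l_2'\land split\,l'\,l_1'\,l_2')))$; (10) $\forall l(list\,l\supset\forall l'\forall l_1\forall l_1'\forall l_2\forall l_2'(list\,l'\supset split\,l\,l_1\,l_2\supset split\,l'\,l_1'\,l_2'\supset permute\,l_1\,l_1'\supset permute\,l_2\,l_2'\supset permute\,l\,l'))$.
   Context: $FO\lambda^{\Delta\mathbb{N}}$ is the following intuitionistic sequent calculus. Terms are simply typed $\lambda$-terms (up to $\alpha\beta\eta$-conversion) over a signature of typed constants; $o$ is the type of formulas, and quantifiers range only over types not containing $o$. Formulas are built from atomic formulas with $\bot,\top,\land,\lor,\supset,\forall,\exists$. There is a type $nt$ with constants $z:nt$, $s:nt\to nt$ and a predicate $nat: nt\to o$. Sequents are $\Gamma\longrightarrow B$, $\Gamma$ a finite multiset. Rules: $\bot,\Gamma\longrightarrow B$ and $\Gamma\longrightarrow\top$ are axioms; the usual intuitionistic left and right rules for $\land,\lor,\supset,\forall,\exists$ (with the usual eigenvariable conditions); initial sequents $A,\Gamma\longrightarrow A$ for atomic $A$; left contraction; cut. For $nat$: $\Gamma\longrightarrow nat\,z$; from $\Gamma\longrightarrow nat\,I$ infer $\Gamma\longrightarrow nat\,(s\,I)$; induction: for $B:nt\to o$ and eigenvariable $j$ not free in $B$, from $\longrightarrow B\,z$, $B\,j\longrightarrow B\,(s\,j)$, $B\,I,\Gamma\longrightarrow C$ infer $nat\,I,\Gamma\longrightarrow C$. Relative to a definition (set of clauses $\forall\bar x[p\,\bar t\triangleq B]$, free variables of $B$ occurring in $\bar t$,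 satisfying a level condition): right rule: from $\Gamma\longrightarrow B\theta$ infer $\Gamma\longrightarrow p\,\bar u$ when $p\,\bar u=(p\,\bar t)\theta$; left rule: infer $p\,\bar u,\Gamma\longrightarrow C$ from the premises $B\theta,\Gamma\theta\longrightarrow C\theta$ for every clause (renamed apart) and every $\theta$ in a complete set of unifiers of $p\,\bar u$ and $p\,\bar t$. A formula is derivable using a definition if $\longrightarrow F$ has a derivation. For a fixed type $\tau$, $lst$ is a type with constants $nil: lst$ and infix $::\,:\tau\to lst\to lst$. $\mathcal{D}_{list}(\tau)$ is the definition with predicates $length: lst\to nt\to o$, $list: lst\to o$, $element:\tau\to lst\to o$, $split: lst\to lst\to lst\to o$, $permute: lst\to lst\to o$ and clauses: $length\,nil\,z\triangleq\top$; $length\,(X::L)\,(s\,I)\triangleq length\,L\,I$; $list\,L\triangleq\exists i(nat\,i\land length\,L\,i)$; $element\,X\,(X::L)\triangleq\top$; $element\,X\,(Y::L)\triangleq element\,X\,L$; $split\,nil\,nil\,nil\triangleq\top$; $split\,(X::L_1)\,(X::L_2)\,L_3\triangleq split\,L_1\,L_2\,L_3$; $split\,(X::L_1)\,L_2\,(X::L_3)\triangleq split\,L_1\,L_2\,L_3$; $permute\,nil\,nil\triangleq\top$; $permute\,(X::L_1)\,L_2\triangleq\exists l_{22}(split\,L_2\,(X::nil)\,l_{22}\land permute\,L_1\,l_{22})$. -}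

module Defs where

-- Deep embedding of the (first-order fragment of the) sequent calculus
-- FOλ^{ΔN} together with the definition D_list(τ).

open import Data.List using (List; []; _∷_; _++_; map)
open import Data.List.Membership.Propositional using (_∈_)
open import Data.List.Relation.Binary.Permutation.Propositional using (_↭_)
open import Data.Product using (Σ; ∃; _×_; _,_)
open import Relation.Binary.PropositionalEquality using (_≡_)

-- Sorts (base types).  ι is the fixed element type τ, nt the naturals,
-- lst the lists over τ.

data Sort : Set where
  ι nt lst : Sort

Ctx : Set
Ctx = List Sort

data Var : Ctx → Sort → Set where
  vz : ∀ {Δ s} → Var (s ∷ Δ) s
  vs : ∀ {Δ s t} → Var Δ s → Var (t ∷ Δ) s

infixr 5 _∷ₜ_
data Tm (Δ : Ctx) : Sort → Set where
  var  : ∀ {s} → Var Δ s → Tm Δ s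
  zₜ   : Tm Δ nt
  sₜ   : Tm Δ nt → Tm Δ nt
  nilₜ : Tm Δ lst
  _∷ₜ_ : Tm Δ ι → Tm Δ lst → Tm Δ lst

data DAtom (Δ : Ctx) : Set where
  length  : Tm Δ lst → Tm Δ nt → DAtom Δ
  list    : Tm Δ lst → DAtom Δ
  element : Tm Δ ι → Tm Δ lst → DAtom Δ
  split   : Tm Δ lst → Tm Δ lst → Tm Δ lst → DAtom Δ
  permute : Tm Δ lst → Tm Δ lst → DAtom Δ

data Atom (Δ : Ctx) : Set where
  nat : Tm Δ nt → Atom Δ
  def : DAtom Δ → Atom Δ

infixr 4 _⊃_
infixr 5 _∨'_
infixr 6 _∧'_
data Fm (Δ : Ctx) : Set where
  atom : Atom Δ → Fm Δ
  ⊥' ⊤' : Fm Δ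
  _∧'_ _∨'_ _⊃_ : Fm Δ → Fm Δ → Fm Δ
  all ex : (s : Sort) → Fm (s ∷ Δ) → Fm Δ

Ren : Ctx → Ctx → Set
Ren Δ Δ' = ∀ {s} → Var Δ s → Var Δ' s

Sub : Ctx → Ctx → Set
Sub Δ Δ' = ∀ {s} → Var Δ s → Tm Δ' s

liftR : ∀ {Δ Δ' t} → Ren Δ Δ' → Ren (t ∷ Δ) (t ∷ Δ')
liftR r vz     = vz
liftR r (vs x) = vs (r x)

renT : ∀ {Δ Δ' s} → Ren Δ Δ' → Tm Δ s → Tm Δ' s
renT r (var x)  = var (r x)
renT r zₜ       = zₜ
renT r (sₜ t)   = sₜ (renT r t)
renT r nilₜ     = nilₜ
renT r (x ∷ₜ l) = renT r x ∷ₜ renT r l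

exts : ∀ {Δ Δ' t} → Sub Δ Δ' → Sub (t ∷ Δ) (t ∷ Δ')
exts σ vz     = var vz
exts σ (vs x) = renT vs (σ x)

subT : ∀ {Δ Δ' s} → Sub Δ Δ' → Tm Δ s → Tm Δ' s
subT σ (var x)  = σ x
subT σ zₜ       = zₜ
subT σ (sₜ t)   = sₜ (subT σ t)
subT σ nilₜ     = nilₜ
subT σ (x ∷ₜ l) = subT σ x ∷ₜ subT σ l

subD : ∀ {Δ Δ'} → Sub Δ Δ' → DAtom Δ → DAtom Δ'
subD σ (length l n)     = length (subT σ l) (subT σ n)
subD σ (list l)         = list (subT σ l)
subD σ (element x l)    = element (subT σ x) (subT σ l)
subD σ (split l l₁ l₂)  = split (subT σ l) (subT σ l₁) (subT σ l₂)
subD σ (permute l l')   = permute (subT σ l) (subT σ l')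

subA : ∀ {Δ Δ'} → Sub Δ Δ' → Atom Δ → Atom Δ'
subA σ (nat n) = nat (subT σ n)
subA σ (def a) = def (subD σ a)

subF : ∀ {Δ Δ'} → Sub Δ Δ' → Fm Δ → Fm Δ'
subF σ (atom a)  = atom (subA σ a)
subF σ ⊥'        = ⊥'
subF σ ⊤'        = ⊤'
subF σ (A ∧' B)  = subF σ A ∧' subF σ B
subF σ (A ∨' B)  = subF σ A ∨' subF σ B
subF σ (A ⊃ B)   = subF σ A ⊃ subF σ B
subF σ (all s B) = all s (subF (exts σ) B)
subF σ (ex s B)  = ex s (subF (exts σ) B)

wkF : ∀ {Δ t} → Fm Δ → Fm (t ∷ Δ)
wkF = subF (λ x → var (vs x))

sub1 : ∀ {Δ s} → Tm Δ s → Sub (s ∷ Δ) Δ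
sub1 t vz     = t
sub1 t (vs x) = var x

subSucc : ∀ {Δ} → Sub (nt ∷ Δ) (nt ∷ Δ)
subSucc vz     = sₜ (var vz)
subSucc (vs x) = var (vs x)

-- The definition D_list(τ):  clauses  ∀x̄ [ p t̄ ≜ B ]

v0 : ∀ {Δ s} → Tm (s ∷ Δ) s
v0 = var vz
v1 : ∀ {Δ s t} → Tm (t ∷ s ∷ Δ) s
v1 = var (vs vz)
v2 : ∀ {Δ s t u} → Tm (u ∷ t ∷ s ∷ Δ) s
v2 = var (vs (vs vz))
v3 : ∀ {Δ s t u w} → Tm (w ∷ u ∷ t ∷ s ∷ Δ) s
v3 = var (vs (vs (vs vz)))
v4 : ∀ {Δ s t u w y} → Tm (y ∷ w ∷ u ∷ t ∷ s ∷ Δ) s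
v4 = var (vs (vs (vs (vs vz))))
v5 : ∀ {Δ s t u w y q} → Tm (q ∷ y ∷ w ∷ u ∷ t ∷ s ∷ Δ) s
v5 = var (vs (vs (vs (vs (vs vz)))))

dA : ∀ {Δ} → DAtom Δ → Fm Δ
dA a = atom (def a)

data ClauseId : Set where
  len-nil len-cons list-def elem-hd elem-tl
    split-nil split-l split-r perm-nil perm-cons : ClauseId

-- clause variables x̄  (listed innermost first: vz is the head of the list)
cvars : ClauseId → Ctx
cvars len-nil   = []
cvars len-cons  = ι ∷ lst ∷ nt ∷ []
cvars list-def  = lst ∷ []
cvars elem-hd   = ι ∷ lst ∷ []
cvars elem-tl   = ι ∷ ι ∷ lst ∷ []
cvars split-nil = []
cvars split-l   = ι ∷ lst ∷ lst ∷ lst ∷ []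
cvars split-r   = ι ∷ lst ∷ lst ∷ lst ∷ []
cvars perm-nil  = []
cvars perm-cons = ι ∷ lst ∷ lst ∷ []

chead : (c : ClauseId) → DAtom (cvars c)
chead len-nil   = length nilₜ zₜ
chead len-cons  = length (v0 ∷ₜ v1) (sₜ v2)
chead list-def  = list v0
chead elem-hd   = element v0 (v0 ∷ₜ v1)
chead elem-tl   = element v0 (v1 ∷ₜ v2)
chead split-nil = split nilₜ nilₜ nilₜ
chead split-l   = split (v0 ∷ₜ v1) (v0 ∷ₜ v2) v3
chead split-r   = split (v0 ∷ₜ v1) v2 (v0 ∷ₜ v3)
chead perm-nil  = permute nilₜ nilₜ
chead perm-cons = permute (v0 ∷ₜ v1) v2

cbody : (c : ClauseId) → Fm (cvars c)
cbody len-nil   = ⊤'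
cbody len-cons  = dA (length v1 v2)
cbody list-def  = ex nt (atom (nat v0) ∧' dA (length v1 v0))
cbody elem-hd   = ⊤'
cbody elem-tl   = dA (element v0 v2)
cbody split-nil = ⊤'
cbody split-l   = dA (split v1 v2 v3)
cbody split-r   = dA (split v1 v2 v3)
cbody perm-nil  = ⊤'
cbody perm-cons = ex lst (dA (split v3 (v1 ∷ₜ nilₜ) v0) ∧' dA (permute v2 v0))

-- Unifiers and complete sets of unifiers of  p ū  (eigenvariables Δ)
-- and a clause head  p t̄  (clause variables V, renamed apart).
-- A unifier is a substitution on the disjoint union of the variables,
-- presented as the pair (θ on Δ, ρ on V).

record Unifier {Δ V : Ctx} (a : DAtom Δ) (h : DAtom V) : Set where
  constructor unifier
  field
    tgt     : Ctx
    θ       : Sub Δ tgt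
    ρ       : Sub V tgt
    unifies : subD θ a ≡ subD ρ h

record CSU {Δ V : Ctx} (a : DAtom Δ) (h : DAtom V) : Set where
  field
    unifiers : List (Unifier a h)
    complete : ∀ (Δ'' : Ctx) (θ' : Sub Δ Δ'') (ρ' : Sub V Δ'') →
               subD θ' a ≡ subD ρ' h →
               Σ (Unifier a h) λ u → u ∈ unifiers ×
                 Σ (Sub (Unifier.tgt u) Δ'') λ δ →
                   (∀ {s} (x : Var Δ s) → θ' x ≡ subT δ (Unifier.θ u x)) ×
                   (∀ {s} (x : Var V s) → ρ' x ≡ subT δ (Unifier.ρ u x))

-- Sequents  Γ ⟶ C  over eigenvariable context Δ; Γ a multiset
-- (a list up to permutation, see the exchange rule).

data Der : (Δ : Ctx) → List (Fm Δ) → Fm Δ → Set where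
  exch  : ∀ {Δ Γ Γ' C} → Γ ↭ Γ' → Der Δ Γ C → Der Δ Γ' C
  contr : ∀ {Δ B Γ C} → Der Δ (B ∷ B ∷ Γ) C → Der Δ (B ∷ Γ) C
  init  : ∀ {Δ Γ} (A : Atom Δ) → Der Δ (atom A ∷ Γ) (atom A)
  cut   : ∀ {Δ Γ₁ Γ₂ B C} → Der Δ Γ₁ B → Der Δ (B ∷ Γ₂) C → Der Δ (Γ₁ ++ Γ₂) C
  ⊥L    : ∀ {Δ Γ C} → Der Δ (⊥' ∷ Γ) C
  ⊤R    : ∀ {Δ Γ} → Der Δ Γ ⊤'
  ∧L₁   : ∀ {Δ A B Γ C} → Der Δ (A ∷ Γ) C → Der Δ ((A ∧' B) ∷ Γ) C
  ∧L₂   : ∀ {Δ A B Γ C} → Der Δ (B ∷ Γ) C → Der Δ ((A ∧' B) ∷ Γ) C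
  ∧R    : ∀ {Δ Γ A B} → Der Δ Γ A → Der Δ Γ B → Der Δ Γ (A ∧' B)
  ∨L    : ∀ {Δ A B Γ C} → Der Δ (A ∷ Γ) C → Der Δ (B ∷ Γ) C → Der Δ ((A ∨' B) ∷ Γ) C
  ∨R₁   : ∀ {Δ Γ A B} → Der Δ Γ A → Der Δ Γ (A ∨' B)
  ∨R₂   : ∀ {Δ Γ A B} → Der Δ Γ B → Der Δ Γ (A ∨' B)
  ⊃L    : ∀ {Δ A B Γ C} → Der Δ Γ A → Der Δ (B ∷ Γ) C → Der Δ ((A ⊃ B) ∷ Γ) C
  ⊃R    : ∀ {Δ Γ A B} → Der Δ (A ∷ Γ) B → Der Δ Γ (A ⊃ B)
  ∀L    : ∀ {Δ s B Γ C} (t : Tm Δ s) → Der Δ (subF (sub1 t) B ∷ Γ) C → Der Δ (all s B ∷ Γ) C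
  ∀R    : ∀ {Δ s Γ B} → Der (s ∷ Δ) (map wkF Γ) B → Der Δ Γ (all s B)
  ∃L    : ∀ {Δ s B Γ C} → Der (s ∷ Δ) (B ∷ map wkF Γ) (wkF C) → Der Δ (ex s B ∷ Γ) C
  ∃R    : ∀ {Δ s Γ B} (t : Tm Δ s) → Der Δ Γ (subF (sub1 t) B) → Der Δ Γ (ex s B)
  natz  : ∀ {Δ Γ} → Der Δ Γ (atom (nat zₜ))
  nats  : ∀ {Δ Γ I} → Der Δ Γ (atom (nat I)) → Der Δ Γ (atom (nat (sₜ I)))
  -- induction: B : nt → o is  B ∈ Fm (nt ∷ Δ); in the step premise the
  -- eigenvariable j is the new variable vz (not free in B's parameters).
  ind   : ∀ {Δ Γ C} (B : Fm (nt ∷ Δ)) (I : Tm Δ nt) →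
          Der Δ [] (subF (sub1 zₜ) B) →
          Der (nt ∷ Δ) (B ∷ []) (subF subSucc B) →
          Der Δ (subF (sub1 I) B ∷ Γ) C →
          Der Δ (atom (nat I) ∷ Γ) C
  defR  : ∀ {Δ Γ} {a : DAtom Δ} (c : ClauseId) (ρ : Sub (cvars c) Δ) →
          a ≡ subD ρ (chead c) →
          Der Δ Γ (subF ρ (cbody c)) →
          Der Δ Γ (dA a)
  defL  : ∀ {Δ Γ C} (a : DAtom Δ) (U : (c : ClauseId) → CSU a (chead c)) →
          (∀ (c : ClauseId) (u : Unifier a (chead c)) → u ∈ CSU.unifiers (U c) →
             Der (Unifier.tgt u) (subF (Unifier.ρ u) (cbody c) ∷ map (subF (Unifier.θ u)) Γ)
                 (subF (Unifier.θ u) C)) →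
          Der Δ (dA a ∷ Γ) C

Derivable : Fm [] → Set
Derivable F = Der [] [] F

Lst : ∀ {Δ} → Tm Δ lst → Fm Δ
Lst l = dA (list l)
Spl : ∀ {Δ} → Tm Δ lst → Tm Δ lst → Tm Δ lst → Fm Δ
Spl l l₁ l₂ = dA (split l l₁ l₂)
Elt : ∀ {Δ} → Tm Δ ι → Tm Δ lst → Fm Δ
Elt x l = dA (element x l)
Prm : ∀ {Δ} → Tm Δ lst → Tm Δ lst → Fm Δ
Prm l l' = dA (permute l l')

F1 : Fm []
F1 = all lst (Lst v0 ⊃ all lst (all lst (Spl v2 v1 v0 ⊃ (Lst v1 ∧' Lst v0))))

F2 : Fm []
F2 = all lst (Lst v0 ⊃ all lst (Lst v0 ⊃ all lst (Spl v0 v2 v1 ⊃ Lst v0)))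

F3 : Fm []
F3 = all lst (Lst v0 ⊃ all lst (all lst (Spl v2 v1 v0 ⊃
       (all ι (Elt v0 v2 ⊃ Elt v0 v3) ∧' all ι (Elt v0 v1 ⊃ Elt v0 v3)))))

F4 : Fm []
F4 = all lst (Lst v0 ⊃ all lst (all lst (Spl v2 v1 v0 ⊃ Spl v2 v0 v1)))

-- (5) binders l l23 l1 l2 l3
F5 : Fm []
F5 = all lst (Lst v0 ⊃ all lst (all lst (all lst (all lst
       (Spl v4 v2 v3 ⊃ Spl v3 v1 v0 ⊃
        ex lst (Spl v5 v0 v1 ∧' Spl v0 v3 v2))))))

-- (6) binders l l12 l1 l2 l3
F6 : Fm []
F6 = all lst (Lst v0 ⊃ all lst (all lst (all lst (all lst
       (Spl v4 v3 v0 ⊃ Spl v3 v2 v1 ⊃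
        ex lst (Spl v5 v3 v0 ∧' Spl v0 v2 v1))))))

F7 : Fm []
F7 = all lst (Lst v0 ⊃ Prm v0 v0)

F8 : Fm []
F8 = all lst (Lst v0 ⊃ all lst (Prm v1 v0 ⊃ Lst v0))

-- (9) binders l l' l1 l2 (then l1' l2')
F9 : Fm []
F9 = all lst (Lst v0 ⊃ all lst (all lst (all lst
       (Lst v2 ⊃ Prm v3 v2 ⊃ Spl v3 v1 v0 ⊃
        ex lst (ex lst (Prm v3 v1 ∧' Prm v2 v0 ∧' Spl v4 v1 v0))))))

-- (10) binders l l' l1 l1' l2 l2'
F10 : Fm []
F10 = all lst (Lst v0 ⊃ all lst (all lst (all lst (all lst (all lst
        (Lst v4 ⊃ Spl v5 v3 v1 ⊃ Spl v4 v2 v0 ⊃ Prm v3 v2 ⊃ Prm v1 v0 ⊃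
         Prm v5 v4))))))

-- Each formula has the shape ∀l (list l ⊃ P l). Unfolding list l yields n with nat n and
-- length l n, so the induction rule for nat, applied to ∀l (length l j ⊃ P l), gives
-- structural induction on lists. In each case the hypotheses on split, element and permute
-- are unfolded by the definition-left rule: against atoms built from nil and ::, every
-- clause head either clashes or has a single most general unifier, so an unfolding has at
-- most one premise per clause.
-- The cases then follow the functional proofs. (2) needs a second induction, on l₂, whose
-- invariant quantifies over the tail of l₁ so that the outer induction hypothesis can be
-- passed in; (9) and (10) move the head x of a permutation x :: m ~ l' across the splits
-- using (1) and (4)–(6) and then apply the induction hypothesis to m.

module Submission where

open import Defs
open import Data.Product using (_×_; _,_; proj₁; proj₂)
open import Data.List using (List; []; _∷_; _++_; map)
open import Data.List.Relation.Unary.Any using (here)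
open import Data.List.Relation.Binary.Permutation.Propositional as ↭ using (_↭_; prep; swap)
open import Data.List.Membership.Propositional using (_∈_)
open import Data.Nat using (ℕ; zero; suc)
open import Data.Empty using (⊥-elim)
open import Relation.Binary.PropositionalEquality using (_≡_; _≢_; refl; sym; trans; cong; cong₂; subst; subst₂)

private variable
  Δ Δ' Δ'' : Ctx
  s t : Sort
  Γ Γ' : List (Fm Δ)
  A B C D : Fm Δ
  x y : Tm Δ ι
  l m l₁ l₂ : Tm Δ lst
  k : Tm Δ nt

cong₃ : ∀ {A B C D : Set} (f : A → B → C → D) {a a' b b' c c'} →
        a ≡ a' → b ≡ b' → c ≡ c' → f a b c ≡ f a' b' c'
cong₃ f refl refl refl = refl

infix 4 _≗ₛ_
_≗ₛ_ : Sub Δ Δ' → Sub Δ Δ' → Set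
σ ≗ₛ τ = ∀ {s} (x : Var _ s) → σ x ≡ τ x

infixr 9 _∘ₛ_
_∘ₛ_ : Sub Δ' Δ'' → Sub Δ Δ' → Sub Δ Δ''
(σ ∘ₛ τ) x = subT σ (τ x)

wk : Sub Δ (t ∷ Δ)
wk x = var (vs x)

subT-cong : {σ τ : Sub Δ Δ'} → σ ≗ₛ τ → (u : Tm Δ s) → subT σ u ≡ subT τ u
subT-cong h (var x)  = h x
subT-cong h zₜ       = refl
subT-cong h (sₜ u)   = cong sₜ (subT-cong h u)
subT-cong h nilₜ     = refl
subT-cong h (x ∷ₜ l) = cong₂ _∷ₜ_ (subT-cong h x) (subT-cong h l)

subD-cong : {σ τ : Sub Δ Δ'} → σ ≗ₛ τ → (a : DAtom Δ) → subD σ a ≡ subD τ a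
subD-cong h (length l n)    = cong₂ length (subT-cong h l) (subT-cong h n)
subD-cong h (list l)        = cong list (subT-cong h l)
subD-cong h (element x l)   = cong₂ element (subT-cong h x) (subT-cong h l)
subD-cong h (split l l₁ l₂) = cong₃ split (subT-cong h l) (subT-cong h l₁) (subT-cong h l₂)
subD-cong h (permute l l')  = cong₂ permute (subT-cong h l) (subT-cong h l')

exts-cong : {σ τ : Sub Δ Δ'} → σ ≗ₛ τ → exts {t = t} σ ≗ₛ exts τ
exts-cong h vz     = refl
exts-cong h (vs x) = cong (renT vs) (h x)

subF-cong : {σ τ : Sub Δ Δ'} → σ ≗ₛ τ → (A : Fm Δ) → subF σ A ≡ subF τ A
subF-cong h (atom (nat n)) = cong (λ n → atom (nat n)) (subT-cong h n)
subF-cong h (atom (def a)) = cong dA (subD-cong h a)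
subF-cong h ⊥'             = refl
subF-cong h ⊤'             = refl
subF-cong h (A ∧' B)       = cong₂ _∧'_ (subF-cong h A) (subF-cong h B)
subF-cong h (A ∨' B)       = cong₂ _∨'_ (subF-cong h A) (subF-cong h B)
subF-cong h (A ⊃ B)        = cong₂ _⊃_ (subF-cong h A) (subF-cong h B)
subF-cong h (all s B)      = cong (all s) (subF-cong (exts-cong h) B)
subF-cong h (ex s B)       = cong (ex s) (subF-cong (exts-cong h) B)

subT-var : (u : Tm Δ s) → subT var u ≡ u
subT-var (var x)  = refl
subT-var zₜ       = refl
subT-var (sₜ u)   = cong sₜ (subT-var u)
subT-var nilₜ     = refl
subT-var (x ∷ₜ l) = cong₂ _∷ₜ_ (subT-var x) (subT-var l)

subD-var : (a : DAtom Δ) → subD var a ≡ a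
subD-var (length l n)    = cong₂ length (subT-var l) (subT-var n)
subD-var (list l)        = cong list (subT-var l)
subD-var (element x l)   = cong₂ element (subT-var x) (subT-var l)
subD-var (split l l₁ l₂) = cong₃ split (subT-var l) (subT-var l₁) (subT-var l₂)
subD-var (permute l l')  = cong₂ permute (subT-var l) (subT-var l')

exts-var : exts {t = t} var ≗ₛ var {Δ = t ∷ Δ}
exts-var vz     = refl
exts-var (vs x) = refl

subF-var : (A : Fm Δ) → subF var A ≡ A
subF-var (atom (nat n)) = cong (λ n → atom (nat n)) (subT-var n)
subF-var (atom (def a)) = cong dA (subD-var a)
subF-var ⊥'             = refl
subF-var ⊤'             = refl
subF-var (A ∧' B)       = cong₂ _∧'_ (subF-var A) (subF-var B)
subF-var (A ∨' B)       = cong₂ _∨'_ (subF-var A) (subF-var B)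
subF-var (A ⊃ B)        = cong₂ _⊃_ (subF-var A) (subF-var B)
subF-var (all s B)      = cong (all s) (trans (subF-cong exts-var B) (subF-var B))
subF-var (ex s B)       = cong (ex s) (trans (subF-cong exts-var B) (subF-var B))

subF-id : {σ : Sub Δ Δ} → σ ≗ₛ var → (A : Fm Δ) → subF σ A ≡ A
subF-id h A = trans (subF-cong h A) (subF-var A)

subT-renT : (σ : Sub Δ' Δ'') (r : Ren Δ Δ') (u : Tm Δ s) → subT σ (renT r u) ≡ subT (λ x → σ (r x)) u
subT-renT σ r (var x)  = refl
subT-renT σ r zₜ       = refl
subT-renT σ r (sₜ u)   = cong sₜ (subT-renT σ r u)
subT-renT σ r nilₜ     = refl
subT-renT σ r (x ∷ₜ l) = cong₂ _∷ₜ_ (subT-renT σ r x) (subT-renT σ r l)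

renT-subT : (r : Ren Δ' Δ'') (σ : Sub Δ Δ') (u : Tm Δ s) → renT r (subT σ u) ≡ subT (λ x → renT r (σ x)) u
renT-subT r σ (var x)  = refl
renT-subT r σ zₜ       = refl
renT-subT r σ (sₜ u)   = cong sₜ (renT-subT r σ u)
renT-subT r σ nilₜ     = refl
renT-subT r σ (x ∷ₜ l) = cong₂ _∷ₜ_ (renT-subT r σ x) (renT-subT r σ l)

subT-∘ : (σ : Sub Δ' Δ'') (τ : Sub Δ Δ') (u : Tm Δ s) → subT σ (subT τ u) ≡ subT (σ ∘ₛ τ) u
subT-∘ σ τ (var x)  = refl
subT-∘ σ τ zₜ       = refl
subT-∘ σ τ (sₜ u)   = cong sₜ (subT-∘ σ τ u)
subT-∘ σ τ nilₜ     = refl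
subT-∘ σ τ (x ∷ₜ l) = cong₂ _∷ₜ_ (subT-∘ σ τ x) (subT-∘ σ τ l)

subD-∘ : (σ : Sub Δ' Δ'') (τ : Sub Δ Δ') (a : DAtom Δ) → subD σ (subD τ a) ≡ subD (σ ∘ₛ τ) a
subD-∘ σ τ (length l n)    = cong₂ length (subT-∘ σ τ l) (subT-∘ σ τ n)
subD-∘ σ τ (list l)        = cong list (subT-∘ σ τ l)
subD-∘ σ τ (element x l)   = cong₂ element (subT-∘ σ τ x) (subT-∘ σ τ l)
subD-∘ σ τ (split l l₁ l₂) = cong₃ split (subT-∘ σ τ l) (subT-∘ σ τ l₁) (subT-∘ σ τ l₂)
subD-∘ σ τ (permute l l')  = cong₂ permute (subT-∘ σ τ l) (subT-∘ σ τ l')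

exts-∘ : (σ : Sub Δ' Δ'') (τ : Sub Δ Δ') → exts {t = t} σ ∘ₛ exts τ ≗ₛ exts (σ ∘ₛ τ)
exts-∘ σ τ vz     = refl
exts-∘ σ τ (vs x) = trans (subT-renT (exts σ) vs (τ x)) (sym (renT-subT vs σ (τ x)))

subF-∘ : (σ : Sub Δ' Δ'') (τ : Sub Δ Δ') (A : Fm Δ) → subF σ (subF τ A) ≡ subF (σ ∘ₛ τ) A
subF-∘ σ τ (atom (nat n)) = cong (λ n → atom (nat n)) (subT-∘ σ τ n)
subF-∘ σ τ (atom (def a)) = cong dA (subD-∘ σ τ a)
subF-∘ σ τ ⊥'             = refl
subF-∘ σ τ ⊤'             = refl
subF-∘ σ τ (A ∧' B)       = cong₂ _∧'_ (subF-∘ σ τ A) (subF-∘ σ τ B)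
subF-∘ σ τ (A ∨' B)       = cong₂ _∨'_ (subF-∘ σ τ A) (subF-∘ σ τ B)
subF-∘ σ τ (A ⊃ B)        = cong₂ _⊃_ (subF-∘ σ τ A) (subF-∘ σ τ B)
subF-∘ σ τ (all s B)      = cong (all s) (trans (subF-∘ (exts σ) (exts τ) B) (subF-cong (exts-∘ σ τ) B))
subF-∘ σ τ (ex s B)       = cong (ex s) (trans (subF-∘ (exts σ) (exts τ) B) (subF-cong (exts-∘ σ τ) B))

sub1-wk : (u : Tm Δ t) (w : Tm Δ s) → subT (sub1 u) (renT vs w) ≡ w
sub1-wk u w = trans (subT-renT (sub1 u) vs w) (subT-var w)

sub1-fresh-wk : (B : Fm (s ∷ Δ)) → subF (sub1 (var vz)) (subF (exts wk) B) ≡ B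
sub1-fresh-wk B = trans (subF-∘ _ _ B) (subF-id (λ { vz → refl ; (vs x) → refl }) B)

∅ : Sub [] Δ
∅ ()

infixl 5 _▸_
_▸_ : Sub Δ Δ'' → Tm Δ'' t → Sub (t ∷ Δ) Δ''
(σ ▸ u) vz     = u
(σ ▸ u) (vs x) = σ x

▸-wk : (σ : Sub Δ Δ') (u : Tm Δ' t) (w : Tm Δ s) → subT (σ ▸ u) (renT vs w) ≡ subT σ w
▸-wk σ u w = subT-renT (σ ▸ u) vs w

▸-wk⁻ : (σ : Sub Δ Δ') (u : Tm Δ' t) (w : Tm Δ s) {w' : Tm Δ' s} → subT σ w ≡ w' → w' ≡ subT (σ ▸ u) (renT vs w)
▸-wk⁻ σ u w e = sym (trans (▸-wk σ u w) e)

infixl 6 _[_≔_]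
_[_≔_] : Sub Δ Δ' → Var Δ s → Tm Δ' s → Sub Δ Δ'
(σ [ vz   ≔ u ]) vz     = u
(σ [ vz   ≔ u ]) (vs y) = σ (vs y)
(σ [ vs x ≔ u ]) vz     = σ vz
(σ [ vs x ≔ u ]) (vs y) = ((λ z → σ (vs z)) [ x ≔ u ]) y

≔-hit : (σ : Sub Δ Δ') (x : Var Δ s) (u : Tm Δ' s) → (σ [ x ≔ u ]) x ≡ u
≔-hit σ vz     u = refl
≔-hit σ (vs x) u = ≔-hit (λ z → σ (vs z)) x u

≔-keep : (σ : Sub Δ Δ') (x y : Var Δ s) (u : Tm Δ' s) → σ y ≡ u → (σ [ x ≔ u ]) y ≡ u
≔-keep σ vz     vz     u e = refl
≔-keep σ vz     (vs y) u e = e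
≔-keep σ (vs x) vz     u e = e
≔-keep σ (vs x) (vs y) u e = ≔-keep (λ z → σ (vs z)) x y u e

≔-factors : (θ' : Sub Δ Δ'') (δ : Sub Δ' Δ'') (σ : Sub Δ Δ') (x : Var Δ s) (u : Tm Δ' s) →
            θ' x ≡ subT δ u → θ' ≗ₛ δ ∘ₛ σ → θ' ≗ₛ δ ∘ₛ (σ [ x ≔ u ])
≔-factors θ' δ σ vz     u e h vz     = e
≔-factors θ' δ σ vz     u e h (vs y) = h (vs y)
≔-factors θ' δ σ (vs x) u e h vz     = h vz
≔-factors θ' δ σ (vs x) u e h (vs y) = ≔-factors (λ z → θ' (vs z)) δ (λ z → σ (vs z)) x u e (λ z → h (vs z)) y

identity : (A : Fm Δ) → Der Δ (A ∷ Γ) A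
identity (atom a)  = init a
identity ⊥'        = ⊥L
identity ⊤'        = ⊤R
identity (A ∧' B)  = ∧R (∧L₁ (identity A)) (∧L₂ (identity B))
identity (A ∨' B)  = ∨L (∨R₁ (identity A)) (∨R₂ (identity B))
identity (A ⊃ B)   = ⊃R (exch (swap _ _ ↭.refl) (⊃L (identity A) (identity B)))
identity (all s B) = ∀R (∀L (var vz) (subst (λ B' → Der _ (B' ∷ _) B) (sym (sub1-fresh-wk B)) (identity B)))
identity (ex s B)  = ∃L (∃R (var vz) (subst (Der _ _) (sym (sub1-fresh-wk B)) (identity B)))

∧L : Der Δ (A ∷ B ∷ Γ) C → Der Δ ((A ∧' B) ∷ Γ) C
∧L d = contr (∧L₁ (exch (swap _ _ ↭.refl) (∧L₂ (exch (swap _ _ ↭.refl) d))))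

∧L₃ : Der Δ (A ∷ B ∷ C ∷ Γ) D → Der Δ ((A ∧' B ∧' C) ∷ Γ) D
∧L₃ d = ∧L (exch (swap _ _ ↭.refl) (∧L (exch (↭.trans (swap _ _ ↭.refl) (prep _ (swap _ _ ↭.refl))) d)))

have : Der Δ [] B → Der Δ (B ∷ Γ) C → Der Δ Γ C
have = cut {Γ₁ = []}

weaken : Der Δ Γ B → Der Δ (Γ ++ Γ') B
weaken {B = B} d = cut d (identity B)

cast : {A A' C C' : Fm Δ} → A ≡ A' → C ≡ C' → Der Δ (A ∷ Γ) C → Der Δ (A' ∷ Γ) C'
cast {Δ} {Γ} = subst₂ (λ A C → Der Δ (A ∷ Γ) C)

toFront : ∀ {X : Set} → ℕ → List X → List X
toFront zero    xs       = xs
toFront (suc n) []       = []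
toFront (suc n) (x ∷ xs) with toFront n xs
... | []     = x ∷ []
... | y ∷ ys = y ∷ x ∷ ys

toFront-↭ : ∀ {X : Set} n (xs : List X) → toFront n xs ↭ xs
toFront-↭ zero    xs       = ↭.refl
toFront-↭ (suc n) []       = ↭.refl
toFront-↭ (suc n) (x ∷ xs) with toFront n xs | toFront-↭ n xs
... | []     | p = prep x p
... | y ∷ ys | p = ↭.trans (swap y x ↭.refl) (prep x p)

bring : ∀ n → Der Δ (toFront n Γ) C → Der Δ Γ C
bring {Γ = Γ} n = exch (toFront-↭ n Γ)

headHyp : List (Fm Δ) → Fm Δ
headHyp []      = ⊤'
headHyp (A ∷ Γ) = A

hyp : ∀ n → Der Δ Γ (headHyp (toFront n Γ))
hyp {Γ = Γ} n = bring n (head-identity (toFront n Γ))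
  where
  head-identity : (Γ : List (Fm Δ)) → Der Δ Γ (headHyp Γ)
  head-identity []      = ⊤R
  head-identity (A ∷ Γ) = identity A

v6 : ∀ {Δ s a b c d e f} → Tm (f ∷ e ∷ d ∷ c ∷ b ∷ a ∷ s ∷ Δ) s
v6 = var (vs (vs (vs (vs (vs (vs vz))))))
v7 : ∀ {Δ s a b c d e f g} → Tm (g ∷ f ∷ e ∷ d ∷ c ∷ b ∷ a ∷ s ∷ Δ) s
v7 = var (vs (vs (vs (vs (vs (vs (vs vz)))))))

record MGU {Δ} (a : DAtom Δ) (c : ClauseId) : Set where
  field
    target    : Ctx
    θ         : Sub Δ target
    ρ         : Sub (cvars c) target
    unifies   : subD θ a ≡ subD ρ (chead c)
    mediator  : Sub Δ Δ'' → Sub (cvars c) Δ'' → Sub target Δ''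
    θ-general : (θ' : Sub Δ Δ'') (ρ' : Sub (cvars c) Δ'') → subD θ' a ≡ subD ρ' (chead c) →
                θ' ≗ₛ mediator θ' ρ' ∘ₛ θ
    ρ-general : (θ' : Sub Δ Δ'') (ρ' : Sub (cvars c) Δ'') → subD θ' a ≡ subD ρ' (chead c) →
                ρ' ≗ₛ mediator θ' ρ' ∘ₛ ρ

data ClauseCase {Δ} (Γ : List (Fm Δ)) (C : Fm Δ) (a : DAtom Δ) (c : ClauseId) : Set where
  clash : (∀ {Δ''} (θ' : Sub Δ Δ'') (ρ' : Sub (cvars c) Δ'') → subD θ' a ≢ subD ρ' (chead c)) →
          ClauseCase Γ C a c
  -- an instance of the clause head: the identity on the eigenvariables is a most general unifier
  match : (ρ : Sub (cvars c) Δ) → a ≡ subD ρ (chead c) →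
          (∀ {Δ''} (θ' : Sub Δ Δ'') (ρ' : Sub (cvars c) Δ'') → subD θ' a ≡ subD ρ' (chead c) → ρ' ≗ₛ θ' ∘ₛ ρ) →
          Der Δ (subF ρ (cbody c) ∷ Γ) C → ClauseCase Γ C a c
  unify : (u : MGU a c) → let open MGU u in
          Der target (subF ρ (cbody c) ∷ map (subF θ) Γ) (subF θ C) → ClauseCase Γ C a c

private
  toUnifier : {a : DAtom Δ} {c : ClauseId} → MGU a c → Unifier a (chead c)
  toUnifier u = unifier target θ ρ unifies where open MGU u

  map-subF-var : (Γ : List (Fm Δ)) → map (subF var) Γ ≡ Γ
  map-subF-var []      = refl
  map-subF-var (A ∷ Γ) = cong₂ _∷_ (subF-var A) (map-subF-var Γ)

  csu : {a : DAtom Δ} {c : ClauseId} → ClauseCase Γ C a c → CSU a (chead c)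
  csu (clash no) = record { unifiers = [] ; complete = λ _ θ' ρ' e → ⊥-elim (no θ' ρ' e) }
  csu {a = a} (match ρ a≡ general _) = record
    { unifiers = unifier _ var ρ (trans (subD-var a) a≡) ∷ []
    ; complete = λ _ θ' ρ' e → _ , here refl , θ' , (λ _ → refl) , general θ' ρ' e }
  csu (unify u _) = record
    { unifiers = toUnifier u ∷ []
    ; complete = λ _ θ' ρ' e → toUnifier u , here refl , mediator θ' ρ' , θ-general θ' ρ' e , ρ-general θ' ρ' e }
    where open MGU u

  premise : {a : DAtom Δ} {c : ClauseId} (k : ClauseCase Γ C a c) (u : Unifier a (chead c)) → u ∈ CSU.unifiers (csu k) →
            Der (Unifier.tgt u) (subF (Unifier.ρ u) (cbody c) ∷ map (subF (Unifier.θ u)) Γ) (subF (Unifier.θ u) C)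
  premise {Δ} {Γ} {C} {c = c} (match ρ _ _ d) _ (here refl) =
    subst₂ (λ Γ' C' → Der Δ (subF ρ (cbody c) ∷ Γ') C') (sym (map-subF-var Γ)) (sym (subF-var C)) d
  premise (unify u d) _ (here refl) = d

defL-cases : (a : DAtom Δ) → (∀ c → ClauseCase Γ C a c) → Der Δ (dA a ∷ Γ) C
defL-cases a k = defL a (λ c → csu (k c)) (λ c → premise (k c))

module _ {Γ : List (Fm Δ)} {C : Fm Δ} where

  list-L : ClauseCase Γ C (list l) list-def → Der Δ (Lst l ∷ Γ) C
  list-L k = defL-cases _ λ where
    list-def  → k
    len-nil   → clash λ _ _ ()
    len-cons  → clash λ _ _ ()
    elem-hd   → clash λ _ _ ()
    elem-tl   → clash λ _ _ ()
    split-nil → clash λ _ _ ()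
    split-l   → clash λ _ _ ()
    split-r   → clash λ _ _ ()
    perm-nil  → clash λ _ _ ()
    perm-cons → clash λ _ _ ()

  length-L : ClauseCase Γ C (length l k) len-nil → ClauseCase Γ C (length l k) len-cons →
             Der Δ (dA (length l k) ∷ Γ) C
  length-L kn kc = defL-cases _ λ where
    len-nil   → kn
    len-cons  → kc
    list-def  → clash λ _ _ ()
    elem-hd   → clash λ _ _ ()
    elem-tl   → clash λ _ _ ()
    split-nil → clash λ _ _ ()
    split-l   → clash λ _ _ ()
    split-r   → clash λ _ _ ()
    perm-nil  → clash λ _ _ ()
    perm-cons → clash λ _ _ ()

  element-L : ClauseCase Γ C (element x l) elem-hd → ClauseCase Γ C (element x l) elem-tl →
              Der Δ (Elt x l ∷ Γ) C
  element-L kh kt = defL-cases _ λ where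
    elem-hd   → kh
    elem-tl   → kt
    len-nil   → clash λ _ _ ()
    len-cons  → clash λ _ _ ()
    list-def  → clash λ _ _ ()
    split-nil → clash λ _ _ ()
    split-l   → clash λ _ _ ()
    split-r   → clash λ _ _ ()
    perm-nil  → clash λ _ _ ()
    perm-cons → clash λ _ _ ()

  split-L : ClauseCase Γ C (split l l₁ l₂) split-nil → ClauseCase Γ C (split l l₁ l₂) split-l →
            ClauseCase Γ C (split l l₁ l₂) split-r → Der Δ (Spl l l₁ l₂ ∷ Γ) C
  split-L kn kl kr = defL-cases _ λ where
    split-nil → kn
    split-l   → kl
    split-r   → kr
    len-nil   → clash λ _ _ ()
    len-cons  → clash λ _ _ ()
    list-def  → clash λ _ _ ()
    elem-hd   → clash λ _ _ ()
    elem-tl   → clash λ _ _ ()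
    perm-nil  → clash λ _ _ ()
    perm-cons → clash λ _ _ ()

  permute-L : ClauseCase Γ C (permute l l₁) perm-nil → ClauseCase Γ C (permute l l₁) perm-cons →
              Der Δ (Prm l l₁ ∷ Γ) C
  permute-L kn kc = defL-cases _ λ where
    perm-nil  → kn
    perm-cons → kc
    len-nil   → clash λ _ _ ()
    len-cons  → clash λ _ _ ()
    list-def  → clash λ _ _ ()
    elem-hd   → clash λ _ _ ()
    elem-tl   → clash λ _ _ ()
    split-nil → clash λ _ _ ()
    split-l   → clash λ _ _ ()
    split-r   → clash λ _ _ ()

module _ {Δ : Ctx} where
  ∷-injective : {x y : Tm Δ ι} {l m : Tm Δ lst} → x ∷ₜ l ≡ y ∷ₜ m → x ≡ y × l ≡ m
  ∷-injective refl = refl , refl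

  s-injective : {j k : Tm Δ nt} → sₜ j ≡ sₜ k → j ≡ k
  s-injective refl = refl

  list-injective : {l m : Tm Δ lst} → list l ≡ list m → l ≡ m
  list-injective refl = refl

  length-injective : {l m : Tm Δ lst} {j k : Tm Δ nt} → length l j ≡ length m k → l ≡ m × j ≡ k
  length-injective refl = refl , refl

  element-injective : {x y : Tm Δ ι} {l m : Tm Δ lst} → element x l ≡ element y m → x ≡ y × l ≡ m
  element-injective refl = refl , refl

  split-injective : {l l₁ l₂ m m₁ m₂ : Tm Δ lst} → split l l₁ l₂ ≡ split m m₁ m₂ → l ≡ m × l₁ ≡ m₁ × l₂ ≡ m₂
  split-injective refl = refl , refl , refl

  permute-injective : {l l' m m' : Tm Δ lst} → permute l l' ≡ permute m m' → l ≡ m × l' ≡ m'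
  permute-injective refl = refl , refl

-- The subscript of a split case is the argument position of the variable that its unifier
-- instantiates. The equation argument of a case is the occurs check: it holds (by refl)
-- exactly when that variable occurs nowhere else in the atom.

module _ {Γ : List (Fm Δ)} {C : Fm Δ} where

  split-nil-case₁₂ : (a b : Var Δ lst) → let θ = var [ a ≔ nilₜ ] [ b ≔ nilₜ ] in
                     Der Δ (⊤' ∷ map (subF θ) Γ) (subF θ C) →
                     ClauseCase Γ C (split nilₜ (var a) (var b)) split-nil
  split-nil-case₁₂ a b = unify record
    { θ = var [ a ≔ nilₜ ] [ b ≔ nilₜ ] ; ρ = ∅
    ; unifies = cong₂ (split nilₜ) (≔-keep _ b a nilₜ (≔-hit var a nilₜ)) (≔-hit _ b nilₜ)
    ; mediator = λ θ' _ → θ'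
    ; θ-general = λ θ' ρ' e → let _ , ea , eb = split-injective e in
        ≔-factors θ' θ' _ b nilₜ eb (≔-factors θ' θ' var a nilₜ ea λ _ → refl)
    ; ρ-general = λ _ _ _ () }

  split-nil-case₀ : (l : Var Δ lst) → let θ = var [ l ≔ nilₜ ] in
                    Der Δ (⊤' ∷ map (subF θ) Γ) (subF θ C) →
                    ClauseCase Γ C (split (var l) nilₜ nilₜ) split-nil
  split-nil-case₀ l = unify record
    { θ = var [ l ≔ nilₜ ] ; ρ = ∅
    ; unifies = cong (λ l' → split l' nilₜ nilₜ) (≔-hit var l nilₜ)
    ; mediator = λ θ' _ → θ'
    ; θ-general = λ θ' ρ' e → ≔-factors θ' θ' var l nilₜ (proj₁ (split-injective e)) λ _ → refl
    ; ρ-general = λ _ _ _ () }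

  split-l-case₀ : (l : Var Δ lst) (x : Tm Δ ι) (m l₂ : Tm Δ lst) → let θ = wk [ l ≔ renT vs x ∷ₜ v0 ] in
                  subD θ (split (var l) (x ∷ₜ m) l₂) ≡ split (renT vs x ∷ₜ v0) (renT vs x ∷ₜ renT vs m) (renT vs l₂) →
                  Der (lst ∷ Δ) (Spl v0 (renT vs m) (renT vs l₂) ∷ map (subF θ) Γ) (subF θ C) →
                  ClauseCase Γ C (split (var l) (x ∷ₜ m) l₂) split-l
  split-l-case₀ l x m l₂ occurs = unify record
    { θ = wk [ l ≔ renT vs x ∷ₜ v0 ] ; ρ = ∅ ▸ renT vs l₂ ▸ renT vs m ▸ v0 ▸ renT vs x ; unifies = occurs
    ; mediator = λ θ' ρ' → θ' ▸ ρ' (vs vz)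
    ; θ-general = λ θ' ρ' e → let e₀ , e₁ , _ = split-injective e ; eˣ , _ = ∷-injective e₁ in
        ≔-factors θ' _ wk l _ (trans e₀ (cong (_∷ₜ ρ' (vs vz)) (▸-wk⁻ θ' _ x eˣ))) λ _ → refl
    ; ρ-general = λ θ' ρ' e → let _ , e₁ , e₂ = split-injective e ; eˣ , eᵐ = ∷-injective e₁ in λ where
        vz                → ▸-wk⁻ θ' _ x eˣ
        (vs vz)           → refl
        (vs (vs vz))      → ▸-wk⁻ θ' _ m eᵐ
        (vs (vs (vs vz))) → ▸-wk⁻ θ' _ l₂ e₂ }

  split-r-case₀ : (l : Var Δ lst) (y : Tm Δ ι) (l₁ n : Tm Δ lst) → let θ = wk [ l ≔ renT vs y ∷ₜ v0 ] in
                  subD θ (split (var l) l₁ (y ∷ₜ n)) ≡ split (renT vs y ∷ₜ v0) (renT vs l₁) (renT vs y ∷ₜ renT vs n) →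
                  Der (lst ∷ Δ) (Spl v0 (renT vs l₁) (renT vs n) ∷ map (subF θ) Γ) (subF θ C) →
                  ClauseCase Γ C (split (var l) l₁ (y ∷ₜ n)) split-r
  split-r-case₀ l y l₁ n occurs = unify record
    { θ = wk [ l ≔ renT vs y ∷ₜ v0 ] ; ρ = ∅ ▸ renT vs n ▸ renT vs l₁ ▸ v0 ▸ renT vs y ; unifies = occurs
    ; mediator = λ θ' ρ' → θ' ▸ ρ' (vs vz)
    ; θ-general = λ θ' ρ' e → let e₀ , _ , e₂ = split-injective e ; eʸ , _ = ∷-injective e₂ in
        ≔-factors θ' _ wk l _ (trans e₀ (cong (_∷ₜ ρ' (vs vz)) (▸-wk⁻ θ' _ y eʸ))) λ _ → refl
    ; ρ-general = λ θ' ρ' e → let _ , e₁ , e₂ = split-injective e ; eʸ , eⁿ = ∷-injective e₂ in λ where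
        vz                → ▸-wk⁻ θ' _ y eʸ
        (vs vz)           → refl
        (vs (vs vz))      → ▸-wk⁻ θ' _ l₁ e₁
        (vs (vs (vs vz))) → ▸-wk⁻ θ' _ n eⁿ }

  split-l-case₁ : (x : Tm Δ ι) (m : Tm Δ lst) (a : Var Δ lst) (l₂ : Tm Δ lst) → let θ = wk [ a ≔ renT vs x ∷ₜ v0 ] in
                  subD θ (split (x ∷ₜ m) (var a) l₂) ≡ split (renT vs x ∷ₜ renT vs m) (renT vs x ∷ₜ v0) (renT vs l₂) →
                  Der (lst ∷ Δ) (Spl (renT vs m) v0 (renT vs l₂) ∷ map (subF θ) Γ) (subF θ C) →
                  ClauseCase Γ C (split (x ∷ₜ m) (var a) l₂) split-l
  split-l-case₁ x m a l₂ occurs = unify record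
    { θ = wk [ a ≔ renT vs x ∷ₜ v0 ] ; ρ = ∅ ▸ renT vs l₂ ▸ v0 ▸ renT vs m ▸ renT vs x ; unifies = occurs
    ; mediator = λ θ' ρ' → θ' ▸ ρ' (vs (vs vz))
    ; θ-general = λ θ' ρ' e → let e₀ , e₁ , _ = split-injective e ; eˣ , _ = ∷-injective e₀ in
        ≔-factors θ' _ wk a _ (trans e₁ (cong (_∷ₜ ρ' (vs (vs vz))) (▸-wk⁻ θ' _ x eˣ))) λ _ → refl
    ; ρ-general = λ θ' ρ' e → let e₀ , _ , e₂ = split-injective e ; eˣ , eᵐ = ∷-injective e₀ in λ where
        vz                → ▸-wk⁻ θ' _ x eˣ
        (vs vz)           → ▸-wk⁻ θ' _ m eᵐ
        (vs (vs vz))      → refl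
        (vs (vs (vs vz))) → ▸-wk⁻ θ' _ l₂ e₂ }

  split-r-case₂ : (x : Tm Δ ι) (m l₁ : Tm Δ lst) (b : Var Δ lst) → let θ = wk [ b ≔ renT vs x ∷ₜ v0 ] in
                  subD θ (split (x ∷ₜ m) l₁ (var b)) ≡ split (renT vs x ∷ₜ renT vs m) (renT vs l₁) (renT vs x ∷ₜ v0) →
                  Der (lst ∷ Δ) (Spl (renT vs m) (renT vs l₁) v0 ∷ map (subF θ) Γ) (subF θ C) →
                  ClauseCase Γ C (split (x ∷ₜ m) l₁ (var b)) split-r
  split-r-case₂ x m l₁ b occurs = unify record
    { θ = wk [ b ≔ renT vs x ∷ₜ v0 ] ; ρ = ∅ ▸ v0 ▸ renT vs l₁ ▸ renT vs m ▸ renT vs x ; unifies = occurs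
    ; mediator = λ θ' ρ' → θ' ▸ ρ' (vs (vs (vs vz)))
    ; θ-general = λ θ' ρ' e → let e₀ , _ , e₂ = split-injective e ; eˣ , _ = ∷-injective e₀ in
        ≔-factors θ' _ wk b _ (trans e₂ (cong (_∷ₜ ρ' (vs (vs (vs vz)))) (▸-wk⁻ θ' _ x eˣ))) λ _ → refl
    ; ρ-general = λ θ' ρ' e → let e₀ , e₁ , _ = split-injective e ; eˣ , eᵐ = ∷-injective e₀ in λ where
        vz                → ▸-wk⁻ θ' _ x eˣ
        (vs vz)           → ▸-wk⁻ θ' _ m eᵐ
        (vs (vs vz))      → ▸-wk⁻ θ' _ l₁ e₁
        (vs (vs (vs vz))) → refl }

  element-hd-case : (z : Var Δ ι) (u : Tm Δ ι) (m : Tm Δ lst) → let θ = var [ z ≔ u ] in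
                    subD θ (element (var z) (u ∷ₜ m)) ≡ element u (u ∷ₜ m) →
                    Der Δ (⊤' ∷ map (subF θ) Γ) (subF θ C) →
                    ClauseCase Γ C (element (var z) (u ∷ₜ m)) elem-hd
  element-hd-case z u m occurs = unify record
    { θ = var [ z ≔ u ] ; ρ = ∅ ▸ m ▸ u ; unifies = occurs
    ; mediator = λ θ' _ → θ'
    ; θ-general = λ θ' ρ' e → let e₀ , e₁ = element-injective e ; eᵘ , _ = ∷-injective e₁ in
        ≔-factors θ' θ' var z u (trans e₀ (sym eᵘ)) λ _ → refl
    ; ρ-general = λ θ' ρ' e → let _ , e₁ = element-injective e ; eᵘ , eᵐ = ∷-injective e₁ in λ where
        vz      → sym eᵘ
        (vs vz) → sym eᵐ }

  element-tl-case : (z u : Tm Δ ι) (m : Tm Δ lst) → Der Δ (Elt z m ∷ Γ) C →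
                    ClauseCase Γ C (element z (u ∷ₜ m)) elem-tl
  element-tl-case z u m = match (∅ ▸ m ▸ u ▸ z) refl λ θ' ρ' e →
    let e₀ , e₁ = element-injective e ; eᵘ , eᵐ = ∷-injective e₁ in λ where
      vz           → sym e₀
      (vs vz)      → sym eᵘ
      (vs (vs vz)) → sym eᵐ

  permute-nil-case : (l : Var Δ lst) → let θ = var [ l ≔ nilₜ ] in
                     Der Δ (⊤' ∷ map (subF θ) Γ) (subF θ C) →
                     ClauseCase Γ C (permute nilₜ (var l)) perm-nil
  permute-nil-case l = unify record
    { θ = var [ l ≔ nilₜ ] ; ρ = ∅
    ; unifies = cong (permute nilₜ) (≔-hit var l nilₜ)
    ; mediator = λ θ' _ → θ'
    ; θ-general = λ θ' ρ' e → ≔-factors θ' θ' var l nilₜ (proj₂ (permute-injective e)) λ _ → refl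
    ; ρ-general = λ _ _ _ () }

  permute-cons-case : (x : Tm Δ ι) (m l : Tm Δ lst) →
                      Der Δ (ex lst (Spl (renT vs l) (renT vs x ∷ₜ nilₜ) v0 ∧' Prm (renT vs m) v0) ∷ Γ) C →
                      ClauseCase Γ C (permute (x ∷ₜ m) l) perm-cons
  permute-cons-case x m l = match (∅ ▸ l ▸ m ▸ x) refl λ θ' ρ' e →
    let e₀ , e₁ = permute-injective e ; eˣ , eᵐ = ∷-injective e₀ in λ where
      vz           → sym eˣ
      (vs vz)      → sym eᵐ
      (vs (vs vz)) → sym e₁

  list-inv : (l : Tm Δ lst) → Der Δ (ex nt (atom (nat v0) ∧' dA (length (renT vs l) v0)) ∷ Γ) C →
             Der Δ (Lst l ∷ Γ) C
  list-inv l d = list-L (match (∅ ▸ l) refl (λ { θ' ρ' e vz → sym (list-injective e) }) d)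

  element-[]-inv : (z : Tm Δ ι) → Der Δ (Elt z nilₜ ∷ Γ) C
  element-[]-inv z = element-L (clash λ _ _ ()) (clash λ _ _ ())

  split-[]-inv : (a b : Var Δ lst) → let θ = var [ a ≔ nilₜ ] [ b ≔ nilₜ ] in
                 Der Δ (⊤' ∷ map (subF θ) Γ) (subF θ C) → Der Δ (Spl nilₜ (var a) (var b) ∷ Γ) C
  split-[]-inv a b d = split-L (split-nil-case₁₂ a b d) (clash λ _ _ ()) (clash λ _ _ ())

  split-∷-inv : (x : Tm Δ ι) (m : Tm Δ lst) (a b : Var Δ lst) →
                let θˡ = wk [ a ≔ renT vs x ∷ₜ v0 ] ; θʳ = wk [ b ≔ renT vs x ∷ₜ v0 ] in
                subD θˡ (split (x ∷ₜ m) (var a) (var b)) ≡ split (renT vs x ∷ₜ renT vs m) (renT vs x ∷ₜ v0) (var (vs b)) →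
                subD θʳ (split (x ∷ₜ m) (var a) (var b)) ≡ split (renT vs x ∷ₜ renT vs m) (var (vs a)) (renT vs x ∷ₜ v0) →
                Der (lst ∷ Δ) (Spl (renT vs m) v0 (var (vs b)) ∷ map (subF θˡ) Γ) (subF θˡ C) →
                Der (lst ∷ Δ) (Spl (renT vs m) (var (vs a)) v0 ∷ map (subF θʳ) Γ) (subF θʳ C) →
                Der Δ (Spl (x ∷ₜ m) (var a) (var b) ∷ Γ) C
  split-∷-inv x m a b occursˡ occursʳ dˡ dʳ =
    split-L (clash λ _ _ ()) (split-l-case₁ x m a (var b) occursˡ dˡ) (split-r-case₂ x m (var a) b occursʳ dʳ)

  permute-[]-inv : (l : Var Δ lst) → let θ = var [ l ≔ nilₜ ] in
                   Der Δ (⊤' ∷ map (subF θ) Γ) (subF θ C) → Der Δ (Prm nilₜ (var l) ∷ Γ) C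
  permute-[]-inv l d = permute-L (permute-nil-case l d) (clash λ _ _ ())

  permute-∷-inv : (x : Tm Δ ι) (m l : Tm Δ lst) →
                  Der Δ (ex lst (Spl (renT vs l) (renT vs x ∷ₜ nilₜ) v0 ∧' Prm (renT vs m) v0) ∷ Γ) C →
                  Der Δ (Prm (x ∷ₜ m) l ∷ Γ) C
  permute-∷-inv x m l d = permute-L (clash λ _ _ ()) (permute-cons-case x m l d)

length-[]-inv : Der Δ (⊤' ∷ map (subF (var ▸ nilₜ)) Γ) (subF (var ▸ nilₜ) C) →
                Der (lst ∷ Δ) (dA (length v0 zₜ) ∷ Γ) C
length-[]-inv d = length-L (unify mgu d) (clash λ _ _ ())
  where
  mgu : MGU (length v0 zₜ) len-nil
  mgu = record
    { θ = var ▸ nilₜ ; ρ = ∅ ; unifies = refl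
    ; mediator = λ θ' _ y → θ' (vs y)
    ; θ-general = λ { θ' ρ' e vz → proj₁ (length-injective e) ; θ' ρ' e (vs y) → refl }
    ; ρ-general = λ _ _ _ () }

length-∷-inv : (j : Var Δ nt) → let θ = (λ y → var (vs (vs y))) ▸ (v0 ∷ₜ v1) in
               Der (ι ∷ lst ∷ Δ) (dA (length v1 (var (vs (vs j)))) ∷ map (subF θ) Γ) (subF θ C) →
               Der (lst ∷ Δ) (dA (length v0 (sₜ (var (vs j)))) ∷ Γ) C
length-∷-inv j d = length-L (clash λ _ _ ()) (unify mgu d)
  where
  mgu : MGU (length v0 (sₜ (var (vs j)))) len-cons
  mgu = record
    { θ = (λ y → var (vs (vs y))) ▸ (v0 ∷ₜ v1) ; ρ = ∅ ▸ var (vs (vs j)) ▸ v1 ▸ v0 ; unifies = refl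
    ; mediator = λ θ' ρ' → (λ y → θ' (vs y)) ▸ ρ' (vs vz) ▸ ρ' vz
    ; θ-general = λ { θ' ρ' e vz → proj₁ (length-injective e) ; θ' ρ' e (vs y) → refl }
    ; ρ-general = λ { θ' ρ' e vz → refl ; θ' ρ' e (vs vz) → refl
                    ; θ' ρ' e (vs (vs vz)) → sym (s-injective (proj₂ (length-injective e))) } }

length-[]R : Der Δ Γ (dA (length nilₜ zₜ))
length-[]R = defR len-nil ∅ refl ⊤R

length-∷R : Der Δ Γ (dA (length l k)) → Der Δ Γ (dA (length (x ∷ₜ l) (sₜ k)))
length-∷R {l = l} {k = k} {x = x} = defR len-cons (∅ ▸ k ▸ l ▸ x) refl

list-R : Der Δ Γ (atom (nat k)) → Der Δ Γ (dA (length l k)) → Der Δ Γ (Lst l)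
list-R {k = k} {l = l} dn dl =
  defR list-def (∅ ▸ l) refl (∃R k (∧R dn (subst (λ l' → Der _ _ (dA (length l' k))) (sym (sub1-wk k l)) dl)))

list-[]R : Der Δ Γ (Lst nilₜ)
list-[]R = list-R natz length-[]R

list-∷ : Der Δ [] (all ι (all lst (Lst v0 ⊃ Lst (v1 ∷ₜ v0))))
list-∷ = ∀R (∀R (⊃R (list-inv v0 (∃L (∧L (list-R (nats (hyp 0)) (length-∷R (hyp 1))))))))

list-∷R : Der Δ Γ (Lst m) → Der Δ Γ (Lst (x ∷ₜ m))
list-∷R {m = m} {x = x} d = have list-∷ (∀L x (∀L m (⊃L d
  (subst (λ x' → Der _ (Lst (x' ∷ₜ m) ∷ _) (Lst (x ∷ₜ m))) (sym (sub1-wk m x)) (hyp 0)))))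

element-hereR : Der Δ Γ (Elt x (x ∷ₜ l))
element-hereR {x = x} {l = l} = defR elem-hd (∅ ▸ l ▸ x) refl ⊤R

element-thereR : Der Δ Γ (Elt x l) → Der Δ Γ (Elt x (y ∷ₜ l))
element-thereR {x = x} {l = l} {y = y} = defR elem-tl (∅ ▸ l ▸ y ▸ x) refl

split-[]R : Der Δ Γ (Spl nilₜ nilₜ nilₜ)
split-[]R = defR split-nil ∅ refl ⊤R

split-ˡR : Der Δ Γ (Spl l l₁ l₂) → Der Δ Γ (Spl (x ∷ₜ l) (x ∷ₜ l₁) l₂)
split-ˡR {l = l} {l₁ = l₁} {l₂ = l₂} {x = x} = defR split-l (∅ ▸ l₂ ▸ l₁ ▸ l ▸ x) refl

split-ʳR : Der Δ Γ (Spl l l₁ l₂) → Der Δ Γ (Spl (x ∷ₜ l) l₁ (x ∷ₜ l₂))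
split-ʳR {l = l} {l₁ = l₁} {l₂ = l₂} {x = x} = defR split-r (∅ ▸ l₂ ▸ l₁ ▸ l ▸ x) refl

permute-[]R : Der Δ Γ (Prm nilₜ nilₜ)
permute-[]R = defR perm-nil ∅ refl ⊤R

permute-∷R : ∀ n → Der Δ Γ (Spl l (x ∷ₜ nilₜ) n) → Der Δ Γ (Prm m n) → Der Δ Γ (Prm (x ∷ₜ m) l)
permute-∷R {l = l} {x = x} {m = m} n ds dp =
  defR perm-cons (∅ ▸ l ▸ m ▸ x) refl (∃R n (∧R
    (subst₂ (λ l' x' → Der _ _ (Spl l' (x' ∷ₜ nilₜ) n)) (sym (sub1-wk n l)) (sym (sub1-wk n x)) ds)
    (subst (λ m' → Der _ _ (Prm m' n)) (sym (sub1-wk n m)) dp)))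

infix 8 _⟨_⟩
_⟨_⟩ : Fm (lst ∷ []) → Tm Δ lst → Fm Δ
P ⟨ l ⟩ = subF (∅ ▸ l) P

⟨⟩-sub : (σ : Sub Δ Δ') (P : Fm (lst ∷ [])) (l : Tm Δ lst) → subF σ (P ⟨ l ⟩) ≡ P ⟨ subT σ l ⟩
⟨⟩-sub σ P l = trans (subF-∘ σ (∅ ▸ l) P) (subF-cong (λ { vz → refl }) P)

⟨⟩-sub² : (σ : Sub Δ' Δ'') (τ : Sub Δ Δ') (P : Fm (lst ∷ [])) (l : Tm Δ lst) →
          subF σ (subF τ (P ⟨ l ⟩)) ≡ P ⟨ subT σ (subT τ l) ⟩
⟨⟩-sub² σ τ P l = trans (cong (subF σ) (⟨⟩-sub τ P l)) (⟨⟩-sub σ P (subT τ l))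

∀List : Fm (lst ∷ []) → Fm Δ
∀List P = all lst (Lst v0 ⊃ P ⟨ v0 ⟩)

listInduction : (P : Fm (lst ∷ [])) →
                (∀ {Δ} → Der Δ [] (P ⟨ nilₜ ⟩)) →
                (∀ {Δ} → Der (ι ∷ lst ∷ Δ) (P ⟨ v1 ⟩ ∷ Lst v1 ∷ []) (P ⟨ v0 ∷ₜ v1 ⟩)) →
                Der Δ [] (∀List P)
listInduction {Δ} P base step = ∀R (⊃R (list-inv v0 (∃L (∧L (ind Inv v0 zero-case succ-case conclude)))))
  where
  -- carrying list l along lets the step case assume list m
  Inv : Fm (nt ∷ nt ∷ lst ∷ Δ)
  Inv = all lst (dA (length v0 v1) ⊃ P ⟨ v0 ⟩ ∧' Lst v0)

  zero-case : Der (nt ∷ lst ∷ Δ) [] (subF (sub1 zₜ) Inv)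
  zero-case = ∀R (⊃R (length-[]-inv (∧R (subst (Der _ _) (sym (⟨⟩-sub² _ _ P v0)) (weaken base)) list-[]R)))

  succ-case : Der (nt ∷ nt ∷ lst ∷ Δ) (Inv ∷ []) (subF subSucc Inv)
  succ-case = ∀R (⊃R (length-∷-inv vz (bring 1 (∀L v1 (⊃L (hyp 0) (∧L (∧R
    (cast (sym (trans (cong (subF _) (⟨⟩-sub² _ _ P v0)) (⟨⟩-sub _ P _))) (sym (⟨⟩-sub² _ _ P v0)) (weaken step))
    (list-∷R (hyp 1)))))))))

  conclude : Der (nt ∷ lst ∷ Δ) (subF (sub1 v0) Inv ∷ dA (length v1 v0) ∷ []) (wkF (P ⟨ v0 ⟩))
  conclude = ∀L v1 (⊃L (hyp 0) (∧L₁ (cast (sym (⟨⟩-sub² _ _ P v0)) (sym (⟨⟩-sub _ P v0)) (hyp 0))))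

SplitLists : Fm (lst ∷ [])
SplitLists = all lst (all lst (Spl v2 v1 v0 ⊃ Lst v1 ∧' Lst v0))

split-lists : Der Δ [] (∀List SplitLists)
split-lists = listInduction SplitLists base step
  where
  base : Der Δ [] (SplitLists ⟨ nilₜ ⟩)
  base = ∀R (∀R (⊃R (split-[]-inv (vs vz) vz (∧R list-[]R list-[]R))))
  step : Der (ι ∷ lst ∷ Δ) (SplitLists ⟨ v1 ⟩ ∷ Lst v1 ∷ []) (SplitLists ⟨ v0 ∷ₜ v1 ⟩)
  step = ∀R (∀R (⊃R (split-∷-inv v2 v3 (vs vz) vz refl refl
    (bring 1 (∀L v0 (∀L v1 (⊃L (hyp 0) (∧L (∧R (list-∷R (hyp 0)) (hyp 1)))))))
    (bring 1 (∀L v2 (∀L v0 (⊃L (hyp 0) (∧L (∧R (hyp 0) (list-∷R (hyp 1)))))))))))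

SplitComm : Fm (lst ∷ [])
SplitComm = all lst (all lst (Spl v2 v1 v0 ⊃ Spl v2 v0 v1))

split-comm : Der Δ [] (∀List SplitComm)
split-comm = listInduction SplitComm base step
  where
  base : Der Δ [] (SplitComm ⟨ nilₜ ⟩)
  base = ∀R (∀R (⊃R (split-[]-inv (vs vz) vz split-[]R)))
  step : Der (ι ∷ lst ∷ Δ) (SplitComm ⟨ v1 ⟩ ∷ Lst v1 ∷ []) (SplitComm ⟨ v0 ∷ₜ v1 ⟩)
  step = ∀R (∀R (⊃R (split-∷-inv v2 v3 (vs vz) vz refl refl
    (split-ʳR (bring 1 (∀L v0 (∀L v1 (⊃L (hyp 0) (hyp 0))))))
    (split-ˡR (bring 1 (∀L v2 (∀L v0 (⊃L (hyp 0) (hyp 0)))))))))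

SplitSubset : Fm (lst ∷ [])
SplitSubset = all lst (all lst (Spl v2 v1 v0 ⊃ (all ι (Elt v0 v2 ⊃ Elt v0 v3) ∧' all ι (Elt v0 v1 ⊃ Elt v0 v3))))

split-⊆ : Der Δ [] (∀List SplitSubset)
split-⊆ = listInduction SplitSubset base step
  where
  base : Der Δ [] (SplitSubset ⟨ nilₜ ⟩)
  base = ∀R (∀R (⊃R (split-[]-inv (vs vz) vz
         (∧R (∀R (⊃R (element-[]-inv v0))) (∀R (⊃R (element-[]-inv v0)))))))
  step : Der (ι ∷ lst ∷ Δ) (SplitSubset ⟨ v1 ⟩ ∷ Lst v1 ∷ []) (SplitSubset ⟨ v0 ∷ₜ v1 ⟩)
  step = ∀R (∀R (⊃R (split-∷-inv v2 v3 (vs vz) vz refl refl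
    (bring 1 (∀L v0 (∀L v1 (⊃L (hyp 0) (∧L (∧R
      (∀R (⊃R (element-L (element-hd-case vz v4 v1 refl element-hereR)
                           (element-tl-case v0 v4 v1 (element-thereR (bring 1 (∀L v0 (⊃L (hyp 0) (hyp 0)))))))))
      (∀R (⊃R (element-thereR (bring 2 (∀L v0 (⊃L (hyp 0) (hyp 0)))))))))))))
    (bring 1 (∀L v2 (∀L v0 (⊃L (hyp 0) (∧L (∧R
      (∀R (⊃R (element-thereR (bring 1 (∀L v0 (⊃L (hyp 0) (hyp 0)))))))
      (∀R (⊃R (element-L (element-hd-case vz v4 v1 refl element-hereR)
                           (element-tl-case v0 v4 v1 (element-thereR (bring 2 (∀L v0 (⊃L (hyp 0) (hyp 0))))))))))))))))))

SplitAssocˡ : Fm (lst ∷ [])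
SplitAssocˡ = all lst (all lst (all lst (all lst (Spl v4 v2 v3 ⊃ Spl v3 v1 v0 ⊃ ex lst (Spl v5 v0 v1 ∧' Spl v0 v3 v2)))))

split-assocˡ : Der Δ [] (∀List SplitAssocˡ)
split-assocˡ = listInduction SplitAssocˡ base step
  where
  base : Der Δ [] (SplitAssocˡ ⟨ nilₜ ⟩)
  base = ∀R (∀R (∀R (∀R (⊃R (split-[]-inv (vs (vs vz)) (vs (vs (vs vz)))
         (⊃R (split-[]-inv (vs vz) vz (∃R nilₜ (∧R split-[]R split-[]R)))))))))
  step : Der (ι ∷ lst ∷ Δ) (SplitAssocˡ ⟨ v1 ⟩ ∷ Lst v1 ∷ []) (SplitAssocˡ ⟨ v0 ∷ₜ v1 ⟩)
  step = ∀R (∀R (∀R (∀R (⊃R (split-∷-inv v4 v5 (vs (vs vz)) (vs (vs (vs vz))) refl refl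
    (⊃R (bring 2 (∀L v4 (∀L v0 (∀L v2 (∀L v1 (⊃L (hyp 1) (⊃L (hyp 0) (∃L (∧L
      (∃R (v6 ∷ₜ v0) (∧R (split-ˡR (hyp 0)) (split-ˡR (hyp 1))))))))))))))
    (⊃R (split-∷-inv v5 v0 (vs (vs vz)) (vs vz) refl refl
      (bring 2 (∀L v1 (∀L v4 (∀L v0 (∀L v2 (⊃L (hyp 1) (⊃L (hyp 0) (∃L (∧L
        (∃R (v7 ∷ₜ v0) (∧R (split-ˡR (hyp 0)) (split-ʳR (hyp 1)))))))))))))
      (bring 2 (∀L v1 (∀L v4 (∀L v3 (∀L v0 (⊃L (hyp 1) (⊃L (hyp 0) (∃L (∧L
        (∃R v0 (∧R (split-ʳR (hyp 0)) (hyp 1)))))))))))))))))))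

SplitAssocʳ : Fm (lst ∷ [])
SplitAssocʳ = all lst (all lst (all lst (all lst (Spl v4 v3 v0 ⊃ Spl v3 v2 v1 ⊃ ex lst (Spl v5 v3 v0 ∧' Spl v0 v2 v1)))))

split-assocʳ : Der Δ [] (∀List SplitAssocʳ)
split-assocʳ = listInduction SplitAssocʳ base step
  where
  base : Der Δ [] (SplitAssocʳ ⟨ nilₜ ⟩)
  base = ∀R (∀R (∀R (∀R (⊃R (split-[]-inv (vs (vs (vs vz))) vz
         (⊃R (split-[]-inv (vs (vs vz)) (vs vz) (∃R nilₜ (∧R split-[]R split-[]R)))))))))
  step : Der (ι ∷ lst ∷ Δ) (SplitAssocʳ ⟨ v1 ⟩ ∷ Lst v1 ∷ []) (SplitAssocʳ ⟨ v0 ∷ₜ v1 ⟩)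
  step = ∀R (∀R (∀R (∀R (⊃R (split-∷-inv v4 v5 (vs (vs (vs vz))) vz refl refl
    (⊃R (split-∷-inv v5 v0 (vs (vs (vs vz))) (vs (vs vz)) refl refl
      (bring 2 (∀L v1 (∀L v0 (∀L v3 (∀L v2 (⊃L (hyp 1) (⊃L (hyp 0) (∃L (∧L
        (∃R v0 (∧R (split-ˡR (hyp 0)) (hyp 1))))))))))))
      (bring 2 (∀L v1 (∀L v4 (∀L v0 (∀L v2 (⊃L (hyp 1) (⊃L (hyp 0) (∃L (∧L
        (∃R (v7 ∷ₜ v0) (∧R (split-ʳR (hyp 0)) (split-ˡR (hyp 1)))))))))))))))
    (⊃R (bring 2 (∀L v4 (∀L v3 (∀L v2 (∀L v0 (⊃L (hyp 1) (⊃L (hyp 0) (∃L (∧L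
      (∃R (v6 ∷ₜ v0) (∧R (split-ʳR (hyp 0)) (split-ʳR (hyp 1)))))))))))))))))))

SplitIdentityˡ : Fm (lst ∷ [])
SplitIdentityˡ = Spl v0 nilₜ v0

split-identityˡ : Der Δ [] (∀List SplitIdentityˡ)
split-identityˡ = listInduction SplitIdentityˡ split-[]R (split-ʳR (hyp 0))

PermuteRefl : Fm (lst ∷ [])
PermuteRefl = Prm v0 v0

permute-refl : Der Δ [] (∀List PermuteRefl)
permute-refl = listInduction PermuteRefl permute-[]R
  (permute-∷R v1 (split-ˡR (have split-identityˡ (∀L v1 (⊃L (hyp 1) (hyp 0))))) (hyp 0))

Split[]List : Fm (lst ∷ [])
Split[]List = all lst (Spl v0 nilₜ v1 ⊃ Lst v0)

split-[]-list : Der Δ [] (∀List Split[]List)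
split-[]-list = listInduction Split[]List base step
  where
  base : Der Δ [] (Split[]List ⟨ nilₜ ⟩)
  base = ∀R (⊃R (split-L (split-nil-case₀ vz list-[]R) (clash λ _ _ ()) (clash λ _ _ ())))
  step : Der (ι ∷ lst ∷ Δ) (Split[]List ⟨ v1 ⟩ ∷ Lst v1 ∷ []) (Split[]List ⟨ v0 ∷ₜ v1 ⟩)
  step = ∀R (⊃R (split-L (clash λ _ _ ()) (clash λ _ _ ()) (split-r-case₀ vz v1 nilₜ v2 refl
         (list-∷R (bring 1 (∀L v0 (⊃L (hyp 0) (hyp 0))))))))

SplitList : Fm (lst ∷ [])
SplitList = all lst (Lst v0 ⊃ all lst (Spl v0 v2 v1 ⊃ Lst v0))

-- ∀x m (SplitList m ⊃ ∀l (split l (x :: m) l₂ ⊃ list l))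
Split∷List : Fm (lst ∷ [])
Split∷List = all ι (all lst (SplitList ⟨ v0 ⟩ ⊃ all lst (Spl v0 (v2 ∷ₜ v1) v3 ⊃ Lst v0)))

split-∷-list : Der Δ [] (∀List Split∷List)
split-∷-list = listInduction Split∷List base step
  where
  base : Der Δ [] (Split∷List ⟨ nilₜ ⟩)
  base = ∀R (∀R (⊃R (∀R (⊃R (split-L (clash λ _ _ ())
    (split-l-case₀ vz v2 v1 nilₜ refl
      (list-∷R (bring 1 (∀L nilₜ (⊃L list-[]R (∀L v0 (⊃L (hyp 0) (hyp 0))))))))
    (clash λ _ _ ()))))))
  step : Der (ι ∷ lst ∷ Δ) (Split∷List ⟨ v1 ⟩ ∷ Lst v1 ∷ []) (Split∷List ⟨ v0 ∷ₜ v1 ⟩)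
  step = ∀R (∀R (⊃R (∀R (⊃R (split-L (clash λ _ _ ())
    (split-l-case₀ vz v2 v1 (v3 ∷ₜ v4) refl
      (list-∷R (bring 1 (∀L (v4 ∷ₜ v5) (⊃L (list-∷R (hyp 2)) (∀L v0 (⊃L (hyp 0) (hyp 0))))))))
    (split-r-case₀ vz v3 (v2 ∷ₜ v1) v4 refl
      (list-∷R (bring 2 (∀L v3 (∀L v2 (⊃L (hyp 1) (∀L v0 (⊃L (hyp 0) (hyp 0))))))))))))))

split-list : Der Δ [] (∀List SplitList)
split-list = listInduction SplitList split-[]-list
  (∀R (⊃R (have split-∷-list (∀L v0 (⊃L (hyp 0) (∀L v1 (∀L v2 (⊃L (hyp 1) (hyp 0)))))))))

PermuteList : Fm (lst ∷ [])
PermuteList = all lst (Prm v1 v0 ⊃ Lst v0)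

permute-list : Der Δ [] (∀List PermuteList)
permute-list = listInduction PermuteList base step
  where
  base : Der Δ [] (PermuteList ⟨ nilₜ ⟩)
  base = ∀R (⊃R (permute-[]-inv vz list-[]R))
  step : Der (ι ∷ lst ∷ Δ) (PermuteList ⟨ v1 ⟩ ∷ Lst v1 ∷ []) (PermuteList ⟨ v0 ∷ₜ v1 ⟩)
  step = ∀R (⊃R (permute-∷-inv v1 v2 v0 (∃L (∧L (bring 2 (∀L v0 (⊃L (hyp 1)
         (have split-list (∀L (v2 ∷ₜ nilₜ) (⊃L (list-∷R list-[]R) (∀L v0 (⊃L (hyp 0) (∀L v1 (⊃L (hyp 1) (hyp 0)))))))))))))))

-- ∀l₁ l₂ x w (split l' l₁ l₂ ⊃ split l₁ [x] w ⊃ ∃u (list u ∧ split l' [x] u ∧ split u w l₂))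
SplitExtractˡ : Fm (lst ∷ [])
SplitExtractˡ = all lst (all lst (all ι (all lst (Spl v4 v3 v2 ⊃ Spl v3 (v1 ∷ₜ nilₜ) v0 ⊃
                  ex lst (Lst v0 ∧' Spl v5 (v2 ∷ₜ nilₜ) v0 ∧' Spl v0 v1 v3)))))

split-extractˡ : Der Δ [] (∀List SplitExtractˡ)
split-extractˡ = ∀R (⊃R (∀R (∀R (∀R (∀R (⊃R (⊃R
  (have split-assocʳ (∀L v4 (⊃L (hyp 2) (∀L v3 (∀L (v1 ∷ₜ nilₜ) (∀L v0 (∀L v2 (⊃L (hyp 1) (⊃L (hyp 0) (∃L (∧L
  (have split-lists (∀L v5 (⊃L (hyp 4) (∀L (v2 ∷ₜ nilₜ) (∀L v0 (⊃L (hyp 0) (∧L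
  (∃R v0 (∧R (hyp 1) (∧R (hyp 2) (hyp 3)))))))))))))))))))))))))))))

-- ∀l₁ l₂ x w (split l' l₁ l₂ ⊃ split l₂ [x] w ⊃ ∃u (list u ∧ split l' [x] u ∧ split u l₁ w))
SplitExtractʳ : Fm (lst ∷ [])
SplitExtractʳ = all lst (all lst (all ι (all lst (Spl v4 v3 v2 ⊃ Spl v2 (v1 ∷ₜ nilₜ) v0 ⊃
                  ex lst (Lst v0 ∧' Spl v5 (v2 ∷ₜ nilₜ) v0 ∧' Spl v0 v4 v1)))))

split-extractʳ : Der Δ [] (∀List SplitExtractʳ)
split-extractʳ = ∀R (⊃R (∀R (∀R (∀R (∀R (⊃R (⊃R
  (have split-comm (∀L v4 (⊃L (hyp 2) (∀L v3 (∀L v2 (⊃L (hyp 1)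
  (have split-extractˡ (∀L v4 (⊃L (hyp 3) (∀L v2 (∀L v3 (∀L v1 (∀L v0 (⊃L (hyp 0) (⊃L (hyp 1) (∃L (∧L₃
  (have split-comm (∀L v0 (⊃L (hyp 0) (∀L v1 (∀L v4 (⊃L (hyp 2)
  (∃R v0 (∧R (hyp 1) (∧R (hyp 2) (hyp 0))))))))))))))))))))))))))))))))))

-- ∀x w a b n (split l' [x] w ⊃ split w a b ⊃ permute n a ⊃ ∃c (permute (x :: n) c ∧ split l' c b))
PermuteConsSplitˡ : Fm (lst ∷ [])
PermuteConsSplitˡ = all ι (all lst (all lst (all lst (all lst (Spl v5 (v4 ∷ₜ nilₜ) v3 ⊃ Spl v3 v2 v1 ⊃ Prm v0 v2 ⊃
                      ex lst (Prm (v5 ∷ₜ v1) v0 ∧' Spl v6 v0 v2))))))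

permute-∷-splitˡ : Der Δ [] (∀List PermuteConsSplitˡ)
permute-∷-splitˡ = ∀R (⊃R (∀R (∀R (∀R (∀R (∀R (⊃R (⊃R (⊃R
  (have split-assocˡ (∀L v5 (⊃L (hyp 3) (∀L v3 (∀L (v4 ∷ₜ nilₜ) (∀L v2 (∀L v1 (⊃L (hyp 2) (⊃L (hyp 1) (∃L (∧L
  (∃R v0 (∧R (permute-∷R v3 (hyp 1) (hyp 2)) (hyp 0)))))))))))))))))))))))

-- ∀x w a b n (split l' [x] w ⊃ split w a b ⊃ permute n b ⊃ ∃c (permute (x :: n) c ∧ split l' a c))
PermuteConsSplitʳ : Fm (lst ∷ [])
PermuteConsSplitʳ = all ι (all lst (all lst (all lst (all lst (Spl v5 (v4 ∷ₜ nilₜ) v3 ⊃ Spl v3 v2 v1 ⊃ Prm v0 v1 ⊃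
                      ex lst (Prm (v5 ∷ₜ v1) v0 ∧' Spl v6 v3 v0))))))

permute-∷-splitʳ : Der Δ [] (∀List PermuteConsSplitʳ)
permute-∷-splitʳ = ∀R (⊃R (∀R (∀R (∀R (∀R (∀R (⊃R (⊃R (⊃R
  (have split-lists (∀L v5 (⊃L (hyp 3) (∀L (v4 ∷ₜ nilₜ) (∀L v3 (⊃L (hyp 2) (∧L
  (have split-comm (∀L v3 (⊃L (hyp 1) (∀L v2 (∀L v1 (⊃L (hyp 3)
  (have permute-∷-splitˡ (∀L v5 (⊃L (hyp 6) (∀L v4 (∀L v3 (∀L v1 (∀L v2 (∀L v0 (⊃L (hyp 5) (⊃L (hyp 0) (⊃L (hyp 3)
  (∃L (∧L
  (have split-comm (∀L v6 (⊃L (hyp 8) (∀L v0 (∀L v3 (⊃L (hyp 1)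
  (∃R v0 (∧R (hyp 1) (hyp 0))))))))))))))))))))))))))))))))))))))))))))

PermuteSplit : Fm (lst ∷ [])
PermuteSplit = all lst (all lst (all lst (Lst v2 ⊃ Prm v3 v2 ⊃ Spl v3 v1 v0 ⊃
                 ex lst (ex lst (Prm v3 v1 ∧' Prm v2 v0 ∧' Spl v4 v1 v0)))))

permute-split : Der Δ [] (∀List PermuteSplit)
permute-split = listInduction PermuteSplit base step
  where
  base : Der Δ [] (PermuteSplit ⟨ nilₜ ⟩)
  base = ∀R (∀R (∀R (⊃R (⊃R (permute-[]-inv (vs (vs vz)) (⊃R (split-[]-inv (vs vz) vz
         (∃R nilₜ (∃R nilₜ (∧R permute-[]R (∧R permute-[]R split-[]R)))))))))))

  head-left : Der (lst ∷ lst ∷ lst ∷ lst ∷ lst ∷ ι ∷ lst ∷ Δ)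
    (Spl v6 v0 v2 ∷ Lst (v5 ∷ₜ nilₜ) ∷ Lst v1 ∷ Spl v4 (v5 ∷ₜ nilₜ) v1 ∷ Prm v6 v1 ∷ Lst v4 ∷ PermuteSplit ⟨ v6 ⟩ ∷ Lst v6 ∷ [])
    (ex lst (ex lst (Prm (v7 ∷ₜ v2) v1 ∧' Prm v4 v0 ∧' Spl v6 v1 v0)))
  head-left = bring 6 (∀L v1 (∀L v0 (∀L v2 (⊃L (hyp 2) (⊃L (hyp 4) (⊃L (hyp 0) (∃L (∃L (∧L₃
    (have permute-∷-splitˡ (∀L v6 (⊃L (hyp 8) (∀L v7 (∀L v3 (∀L v1 (∀L v0 (∀L v2
      (⊃L (hyp 6) (⊃L (hyp 2) (⊃L (hyp 0) (∃L (∧L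
    (∃R v0 (∃R v1 (∧R (hyp 0) (∧R (hyp 3) (hyp 1)))))))))))))))))))))))))))

  head-right : Der (lst ∷ lst ∷ lst ∷ lst ∷ lst ∷ ι ∷ lst ∷ Δ)
    (Spl v6 v3 v0 ∷ Lst (v5 ∷ₜ nilₜ) ∷ Lst v1 ∷ Spl v4 (v5 ∷ₜ nilₜ) v1 ∷ Prm v6 v1 ∷ Lst v4 ∷ PermuteSplit ⟨ v6 ⟩ ∷ Lst v6 ∷ [])
    (ex lst (ex lst (Prm v5 v1 ∧' Prm (v7 ∷ₜ v2) v0 ∧' Spl v6 v1 v0)))
  head-right = bring 6 (∀L v1 (∀L v3 (∀L v0 (⊃L (hyp 2) (⊃L (hyp 4) (⊃L (hyp 0) (∃L (∃L (∧L₃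
    (have permute-∷-splitʳ (∀L v6 (⊃L (hyp 8) (∀L v7 (∀L v3 (∀L v1 (∀L v0 (∀L v2
      (⊃L (hyp 6) (⊃L (hyp 2) (⊃L (hyp 1) (∃L (∧L
    (∃R v2 (∃R v0 (∧R (hyp 2) (∧R (hyp 0) (hyp 1)))))))))))))))))))))))))))

  step : Der (ι ∷ lst ∷ Δ) (PermuteSplit ⟨ v1 ⟩ ∷ Lst v1 ∷ []) (PermuteSplit ⟨ v0 ∷ₜ v1 ⟩)
  step = ∀R (∀R (∀R (⊃R (⊃R (permute-∷-inv v3 v4 v2 (∃L (∧L
    (have split-lists (∀L v3 (⊃L (hyp 2) (∀L (v4 ∷ₜ nilₜ) (∀L v0 (⊃L (hyp 0) (∧L
    (⊃R (split-∷-inv v4 v5 (vs (vs vz)) (vs vz) refl refl head-left head-right))))))))))))))))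

SplitPermute : Fm (lst ∷ [])
SplitPermute = all lst (all lst (all lst (all lst (all lst
                 (Lst v4 ⊃ Spl v5 v3 v1 ⊃ Spl v4 v2 v0 ⊃ Prm v3 v2 ⊃ Prm v1 v0 ⊃ Prm v5 v4)))))

split-permute : Der Δ [] (∀List SplitPermute)
split-permute = listInduction SplitPermute base step
  where
  base : Der Δ [] (SplitPermute ⟨ nilₜ ⟩)
  base = ∀R (∀R (∀R (∀R (∀R (⊃R (⊃R (split-[]-inv (vs (vs (vs vz))) (vs vz)
         (⊃R (⊃R (permute-[]-inv (vs (vs vz)) (⊃R (permute-[]-inv vz
         (bring 2 (split-L (split-nil-case₀ (vs (vs (vs (vs vz)))) permute-[]R) (clash λ _ _ ()) (clash λ _ _ ())))))))))))))))

  head-left : Der (lst ∷ lst ∷ lst ∷ lst ∷ lst ∷ lst ∷ ι ∷ lst ∷ Δ)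
    (Spl v7 v0 v2 ∷ Lst v5 ∷ SplitPermute ⟨ v7 ⟩ ∷ Lst v7 ∷ [])
    (Spl v5 v3 v1 ⊃ Prm (v6 ∷ₜ v0) v3 ⊃ Prm v2 v1 ⊃ Prm (v6 ∷ₜ v7) v5)
  head-left = ⊃R (⊃R (⊃R (bring 1 (permute-∷-inv v6 v0 v3 (∃L (∧L
    (have split-extractˡ (∀L v6 (⊃L (hyp 5) (∀L v4 (∀L v2 (∀L v7 (∀L v0 (⊃L (hyp 3) (⊃L (hyp 0) (∃L (∧L₃
    (permute-∷R v0 (hyp 1)
    (bring 9 (∀L v0 (∀L v2 (∀L v1 (∀L v4 (∀L v3
      (⊃L (hyp 0) (⊃L (hyp 7) (⊃L (hyp 2) (⊃L (hyp 4) (⊃L (hyp 5) (hyp 0))))))))))))))))))))))))))))))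

  head-right : Der (lst ∷ lst ∷ lst ∷ lst ∷ lst ∷ lst ∷ ι ∷ lst ∷ Δ)
    (Spl v7 v4 v0 ∷ Lst v5 ∷ SplitPermute ⟨ v7 ⟩ ∷ Lst v7 ∷ [])
    (Spl v5 v3 v1 ⊃ Prm v4 v3 ⊃ Prm (v6 ∷ₜ v0) v1 ⊃ Prm (v6 ∷ₜ v7) v5)
  head-right = ⊃R (⊃R (⊃R (permute-∷-inv v6 v0 v1 (∃L (∧L
    (have split-extractʳ (∀L v6 (⊃L (hyp 5) (∀L v4 (∀L v2 (∀L v7 (∀L v0 (⊃L (hyp 3) (⊃L (hyp 0) (∃L (∧L₃
    (permute-∷R v0 (hyp 1)
    (bring 9 (∀L v0 (∀L v6 (∀L v5 (∀L v2 (∀L v1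
      (⊃L (hyp 0) (⊃L (hyp 7) (⊃L (hyp 2) (⊃L (hyp 5) (⊃L (hyp 4) (hyp 0)))))))))))))))))))))))))))))

  step : Der (ι ∷ lst ∷ Δ) (SplitPermute ⟨ v1 ⟩ ∷ Lst v1 ∷ []) (SplitPermute ⟨ v0 ∷ₜ v1 ⟩)
  step = ∀R (∀R (∀R (∀R (∀R (⊃R (⊃R
    (split-∷-inv v5 v6 (vs (vs (vs vz))) (vs vz) refl refl head-left head-right)))))))

proposition2p7 : Derivable F1 × Derivable F2 × Derivable F3 × Derivable F4 × Derivable F5 × Derivable F6 × Derivable F7 × Derivable F8 × Derivable F9 × Derivable F10
proposition2p7 = split-lists , split-list , split-⊆ , split-comm , split-assocˡ , split-assocʳ ,
                 permute-refl , permute-list , permute-split , split-permute
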